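{- Let $G$ be a $1$-almost tree with fire source $r$ that lies on a cycle $C = (r, u_1, u_2, \dots, u_p)$ of $G$ (vertices listed in cyclic order). Then for every $h \in \{1, \dots, p\}$ there exists $j \in \{1, p\}$ such that for every $d \in \mathbb{N}$, $$\mathrm{count}(T(C\setminus u_h), d) \le \mathrm{count}(T(C\setminus u_j), d) + w(u_j).$$
   Context: A $1$-almost tree is a connected graph containing at most one simple cycle. For $S \subseteq V(G)\setminus\{r\}$, the covered set $\kappa(S)$ is the set of vertices $u$ such that every path from $u$ to $r$ contains a vertex of $S$; $w(S) = |\kappa(S)|$, $\kappa(v) = \kappa(\{v\})$, $w(v) = w(\{v\})$. For the cycle $C$ through $r$, $\kappa(C) = \kappa(\{u_1,\dots,u_p\})$. For a vertex $u \in \{u_1,\dots,u_p\}$, $T(C\setminus u)$ denotes the subgraph of $G$ induced by $(\{r\} \cup \kappa(C)) \setminus \kappa(u)$. For a graph $H$ containing $r$ and $d \in \mathbb{N}$, $\mathrm{count}(H, d) = |\{v \in V(H) : \mathrm{dist}_H(r, v) \ge d\}|$, where $\mathrm{dist}_H$ is the shortest-path distance in $H$. -}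

module Defs where

open import Data.Nat using (ℕ; zero; suc; _+_; _≤_; _<_)
open import Data.Fin using (Fin; zero; suc)
open import Data.Fin.Subset using (Subset; _∈_; ∣_∣)
open import Data.List using (List; []; _∷_)
open import Data.List.Relation.Unary.Any using (Any)
open import Data.List.Relation.Unary.All using (All)
open import Data.List.Relation.Unary.Unique.Propositional using (Unique)
open import Data.Product using (Σ; ∃; _×_; _,_)
open import Data.Sum using (_⊎_)
open import Relation.Nullary using (¬_)
open import Relation.Binary.PropositionalEquality using (_≡_; _≢_)
open import Function using (_⇔_)
open import Function.Definitions using (Injective)

record Graph : Set₁ where
  field
    n      : ℕ
    Adj    : Fin n → Fin n → Set
    sym    : ∀ {x y} → Adj x y → Adj y x
    irrefl : ∀ {x} → ¬ Adj x x
open Graph public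

module _ (G : Graph) where

  data Walk : Fin (n G) → Fin (n G) → Set where
    []  : ∀ {x} → Walk x x
    _∷_ : ∀ {x y z} → Adj G x y → Walk y z → Walk x z

  len : ∀ {x y} → Walk x y → ℕ
  len []      = 0
  len (_ ∷ w) = suc (len w)

  verts : ∀ {x y} → Walk x y → List (Fin (n G))
  verts {x} []      = x ∷ []
  verts {x} (_ ∷ w) = x ∷ verts w

  IsPath : ∀ {x y} → Walk x y → Set
  IsPath w = Unique (verts w)

  Connected : Set
  Connected = ∀ x y → Walk x y

  -- cyclic successor on Fin (suc m)
  next : ∀ {m} → Fin (suc m) → Fin (suc m)
  next {zero}  zero    = zero
  next {suc m} zero    = suc zero
  next {suc m} (suc i) with next {m} i
  ... | zero  = zero
  ... | suc j = suc (suc j)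

  -- a simple cycle c 0, c 1, ..., c k-1 (k ≥ 3 distinct vertices, cyclically adjacent)
  IsCycle : ∀ {k} → (Fin (suc k) → Fin (n G)) → Set
  IsCycle {k} c = (2 ≤ k) × Injective _≡_ _≡_ c × (∀ i → Adj G (c i) (c (next i)))

  CycleEdge : ∀ {k} → (Fin (suc k) → Fin (n G)) → Fin (n G) → Fin (n G) → Set
  CycleEdge c a b = ∃ λ i → (c i ≡ a × c (next i) ≡ b) ⊎ (c i ≡ b × c (next i) ≡ a)

  -- G contains at most one simple cycle (cycles compared as subgraphs, i.e. edge sets)
  AtMostOneCycle : Set
  AtMostOneCycle = ∀ {k k'} (c : Fin (suc k) → Fin (n G)) (c' : Fin (suc k') → Fin (n G)) →
    IsCycle c → IsCycle c' → ∀ a b → CycleEdge c a b ⇔ CycleEdge c' a b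

  OneAlmostTree : Set
  OneAlmostTree = Connected × AtMostOneCycle

  κ : (r : Fin (n G)) → (Fin (n G) → Set) → Fin (n G) → Set
  κ r S v = ∀ (w : Walk v r) → IsPath w → Any S (verts w)

  -- the vertex set of the subgraph H induced by X contains r and v with dist_H(r,v) ≥ d
  -- (i.e. v ∈ X and there is no walk inside X from r to v of length < d; unreachable = ∞)
  FarIn : (r : Fin (n G)) → (Fin (n G) → Set) → ℕ → Fin (n G) → Set
  FarIn r X d v = X v × (∀ (w : Walk r v) → All X (verts w) → ¬ (len w < d))

  cyc : ∀ {p} → Fin (n G) → (Fin p → Fin (n G)) → Fin (suc p) → Fin (n G)
  cyc r u zero    = r
  cyc r u (suc i) = u i

  -- vertex set of T(C \ u_h) : ({r} ∪ κ(C)) \ κ(u_h)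
  TminusV : ∀ {p} → Fin (n G) → (Fin p → Fin (n G)) → Fin p → Fin (n G) → Set
  TminusV r u h v = (v ≡ r ⊎ κ r (λ x → ∃ λ i → u i ≡ x) v) × ¬ κ r (λ x → x ≡ u h) v

IsCard : ∀ {m} → (Fin m → Set) → ℕ → Set
IsCard {m} P k = Σ (Subset m) λ A → (∀ v → (v ∈ A) ⇔ P v) × ∣ A ∣ ≡ k

module Submission where

-- Number the cycle c 0 = r, c 1 = u₁, …, c p = u_p and let H = h + 1.  It suffices to find
-- J ∈ {1, p} such that every vertex v counted for T(C∖u_h) but not covered by u_J is also counted
-- for T(C∖u_J): a walk of length < d from r to v inside T(C∖u_J) must yield one inside T(C∖u_h).
-- As G has only one cycle, a walk that leaves C at c i and next meets C at c k ≠ c i has i, k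
-- adjacent on C (otherwise the detour and an arc of C would form a second cycle).  So along a walk
-- avoiding c J the last visited vertex c i of C moves along edges of C not at c J, and a potential
-- φ with φ 0 = 0 growing by at most one along such edges stays below the length walked.  If each
-- c i (i ≠ H, J) is reached from r along C, avoiding c H, within φ i steps, replacing the walk up
-- to its last visit of C by that arc gives the required walk; if i = H instead, the rest of the walk
-- and a route from v to r avoiding u_h would again close a second cycle.  For J = p the potential
-- φ i = i works when 2H > p + 3, and for J = 1 the potential φ i = p + 1 − i (i > 0) otherwise.

open import Defs hiding (sym)
open import Data.Nat using (ℕ; zero; suc; _+_; _∸_; _≤_; _<_; z≤n; s≤s; _<?_)
open import Data.Nat.Tactic.RingSolver using (solve-∀)
open import Data.Nat.Properties
  using (≤-refl; ≤-trans; <-trans; ≤-<-trans; <-≤-trans; <⇒≤; <⇒≢; n≤1+n; m≤m+n; m≤n+m;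
         +-suc; +-comm; +-identityʳ; +-monoʳ-≤; +-monoˡ-≤; +-mono-≤; +-cancelˡ-≡; suc-injective;
         <-cmp; m≤n⇒∃[o]m+o≡n; m≤n⇒m<n∨m≡n; m+1+n≢m; m+[n∸m]≡n; m+n∸n≡m; +-∸-assoc; ∸-monoʳ-≤; m+n≤o⇒m≤o∸n;
         m<n+o⇒m∸n<o; +-cancelˡ-≤; +-mono-<; ≤-reflexive; ≮⇒≥; module ≤-Reasoning)
open import Data.Fin using (Fin; zero; suc; toℕ; fromℕ; _≟_)
open import Data.Fin.Properties using (toℕ-injective; toℕ-fromℕ; toℕ≤pred[n]; any?)
open import Data.Fin.Subset using (Subset; outside; inside; ∣_∣; _∪_) renaming (_∈_ to _∈ₛ_)
open import Data.Fin.Subset.Properties using (∣p∣≤∣x∷p∣; p⊆q⇒∣p∣≤∣q∣; x∈p∪q⁺; _∈?_)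
open import Data.List using (List; []; _∷_; _++_; length; lookup; applyUpTo)
open import Data.List.Membership.Propositional using (_∈_)
open import Data.List.Membership.Propositional.Properties using (∈-++⁻; ∈-lookup; ∈-applyUpTo⁻)
open import Data.List.Relation.Binary.Subset.Propositional using (_⊆_)
open import Data.List.Relation.Unary.Any as Any using (Any; here; there)
open import Data.List.Relation.Unary.All as All using (All; []; _∷_)
open import Data.List.Relation.Unary.All.Properties using (¬Any⇒All¬; All¬⇒¬Any; anti-mono; ++⁺)
open import Data.List.Relation.Unary.AllPairs using ([]; _∷_)
open import Data.Vec using () renaming ([] to []ᵛ; _∷_ to _∷ᵛ_)
open import Data.List.Relation.Unary.Unique.Propositional using (Unique)
import Data.List.Relation.Unary.Unique.Propositional.Properties as Unique
open import Data.Product using (Σ; ∃; _×_; _,_; proj₁; proj₂)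
open import Data.Sum using (_⊎_; inj₁; inj₂)
open import Data.Unit using (⊤; tt)
open import Data.Empty using (⊥; ⊥-elim)
open import Relation.Nullary using (¬_; Dec; yes; no)
open import Relation.Binary.PropositionalEquality using (_≡_; _≢_; refl; sym; trans; cong; subst; module ≡-Reasoning)
open import Function.Bundles using (Equivalence)
open import Relation.Binary using (tri<; tri≈; tri>)

lookup-injective : ∀ {A : Set} {xs : List A} → Unique xs → ∀ i j → lookup xs i ≡ lookup xs j → i ≡ j
lookup-injective (_ ∷ _)  zero    zero    _  = refl
lookup-injective (x∉ ∷ _) zero    (suc j) eq = ⊥-elim (All.lookup x∉ (∈-lookup j) eq)
lookup-injective (x∉ ∷ _) (suc i) zero    eq = ⊥-elim (All.lookup x∉ (∈-lookup i) (sym eq))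
lookup-injective (_ ∷ u)  (suc i) (suc j) eq = cong suc (lookup-injective u i j eq)

∣p∪q∣≤∣p∣+∣q∣ : ∀ {m} (p q : Subset m) → ∣ p ∪ q ∣ ≤ ∣ p ∣ + ∣ q ∣
∣p∪q∣≤∣p∣+∣q∣ []ᵛ            []ᵛ            = z≤n
∣p∪q∣≤∣p∣+∣q∣ (outside ∷ᵛ p) (outside ∷ᵛ q) = ∣p∪q∣≤∣p∣+∣q∣ p q
∣p∪q∣≤∣p∣+∣q∣ (outside ∷ᵛ p) (inside ∷ᵛ q)  =
  subst (suc ∣ p ∪ q ∣ ≤_) (sym (+-suc ∣ p ∣ ∣ q ∣)) (s≤s (∣p∪q∣≤∣p∣+∣q∣ p q))
∣p∪q∣≤∣p∣+∣q∣ (inside ∷ᵛ p)  (x ∷ᵛ q)       =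
  s≤s (≤-trans (∣p∪q∣≤∣p∣+∣q∣ p q) (+-monoʳ-≤ ∣ p ∣ (∣p∣≤∣x∷p∣ x q)))

IsCard-≤-+ : ∀ {m} {P Q R : Fin m → Set} {a b c : ℕ} → (∀ v → P v → ¬ R v → Q v) →
  IsCard P a → IsCard Q b → IsCard R c → a ≤ b + c
IsCard-≤-+ P⊆Q∪R (A , A⇔P , refl) (B , B⇔Q , refl) (C , C⇔R , refl) =
  ≤-trans (p⊆q⇒∣p∣≤∣q∣ A⊆B∪C) (∣p∪q∣≤∣p∣+∣q∣ B C)
  where
  A⊆B∪C : ∀ {v} → v ∈ₛ A → v ∈ₛ B ∪ C
  A⊆B∪C {v} v∈A with v ∈? C
  ... | yes v∈C = x∈p∪q⁺ (inj₂ v∈C)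
  ... | no  v∉C = x∈p∪q⁺ (inj₁ (Equivalence.from (B⇔Q v)
        (P⊆Q∪R v (Equivalence.to (A⇔P v) v∈A) (λ Rv → v∉C (Equivalence.from (C⇔R v) Rv)))))

module Walks (G : Graph) where

  V : Set
  V = Fin (n G)

  infixr 5 _++ʷ_
  _++ʷ_ : ∀ {x y z} → Walk G x y → Walk G y z → Walk G x z
  []       ++ʷ w₂ = w₂
  (e ∷ w₁) ++ʷ w₂ = e ∷ (w₁ ++ʷ w₂)

  len-++ʷ : ∀ {x y z} (w₁ : Walk G x y) (w₂ : Walk G y z) → len G (w₁ ++ʷ w₂) ≡ len G w₁ + len G w₂
  len-++ʷ []       w₂ = refl
  len-++ʷ (e ∷ w₁) w₂ = cong suc (len-++ʷ w₁ w₂)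

  source∈verts : ∀ {x y} (w : Walk G x y) → x ∈ verts G w
  source∈verts []      = here refl
  source∈verts (_ ∷ _) = here refl

  target∈verts : ∀ {x y} (w : Walk G x y) → y ∈ verts G w
  target∈verts []      = here refl
  target∈verts (_ ∷ w) = there (target∈verts w)

  verts-++ʷ⊆ : ∀ {x y z} (w₁ : Walk G x y) (w₂ : Walk G y z) → verts G (w₁ ++ʷ w₂) ⊆ verts G w₁ ++ verts G w₂
  verts-++ʷ⊆ []       w₂ v∈          = there v∈
  verts-++ʷ⊆ (e ∷ w₁) w₂ (here refl) = here refl
  verts-++ʷ⊆ (e ∷ w₁) w₂ (there v∈)  = there (verts-++ʷ⊆ w₁ w₂ v∈)

  verts⊆-++ʷˡ : ∀ {x y z} (w₁ : Walk G x y) (w₂ : Walk G y z) → verts G w₁ ⊆ verts G (w₁ ++ʷ w₂)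
  verts⊆-++ʷˡ []       w₂ (here refl) = source∈verts w₂
  verts⊆-++ʷˡ (e ∷ w₁) w₂ (here refl) = here refl
  verts⊆-++ʷˡ (e ∷ w₁) w₂ (there v∈)  = there (verts⊆-++ʷˡ w₁ w₂ v∈)

  All-++ʷ : ∀ {P : V → Set} {x y z} (w₁ : Walk G x y) (w₂ : Walk G y z) →
    All P (verts G w₁) → All P (verts G w₂) → All P (verts G (w₁ ++ʷ w₂))
  All-++ʷ w₁ w₂ P₁ P₂ = anti-mono (verts-++ʷ⊆ w₁ w₂) (++⁺ P₁ P₂)

  infixl 5 _▷_
  _▷_ : ∀ {x y z} → Walk G x y → Adj G y z → Walk G x z
  w ▷ e = w ++ʷ (e ∷ [])

  len-▷ : ∀ {x y z} (w : Walk G x y) (e : Adj G y z) → len G (w ▷ e) ≡ suc (len G w)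
  len-▷ w e = trans (len-++ʷ w (e ∷ [])) (+-comm (len G w) 1)

  verts-▷ : ∀ {x y z} (w : Walk G x y) (e : Adj G y z) → verts G (w ▷ e) ≡ verts G w ++ z ∷ []
  verts-▷ []      e = refl
  verts-▷ (_ ∷ w) e = cong (_ ∷_) (verts-▷ w e)

  All-▷ : ∀ {P : V → Set} {x y z} (w : Walk G x y) (e : Adj G y z) →
    All P (verts G w) → P z → All P (verts G (w ▷ e))
  All-▷ w e Pw Pz = subst (All _) (sym (verts-▷ w e)) (++⁺ Pw (Pz ∷ []))

  reverse : ∀ {x y} → Walk G x y → Walk G y x
  reverse []      = []
  reverse (e ∷ w) = reverse w ▷ Graph.sym G e

  len-reverse : ∀ {x y} (w : Walk G x y) → len G (reverse w) ≡ len G w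
  len-reverse []      = refl
  len-reverse (e ∷ w) = trans (len-▷ (reverse w) _) (cong suc (len-reverse w))

  verts-reverse⊆ : ∀ {x y} (w : Walk G x y) → verts G (reverse w) ⊆ verts G w
  verts-reverse⊆ []      v∈ = v∈
  verts-reverse⊆ (e ∷ w) v∈ with ∈-++⁻ (verts G (reverse w)) (subst (_ ∈_) (verts-▷ (reverse w) _) v∈)
  ... | inj₁ v∈rev       = there (verts-reverse⊆ w v∈rev)
  ... | inj₂ (here refl) = here refl

  reverse-isPath : ∀ {x y} (w : Walk G x y) → IsPath G w → IsPath G (reverse w)
  reverse-isPath []      path          = path
  reverse-isPath (e ∷ w) (x∉w ∷ path) = subst Unique (sym (verts-▷ (reverse w) _))
    (Unique.++⁺ (reverse-isPath w path) ([] ∷ [])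
      λ { (v∈ , here refl) → All.lookup x∉w (verts-reverse⊆ w v∈) refl })

  suffix : ∀ {x y z} (w : Walk G y z) → x ∈ verts G w →
    Σ (Walk G x z) λ w' → verts G w' ⊆ verts G w × (IsPath G w → IsPath G w')
  suffix []      (here refl) = [] , (λ v∈ → v∈) , (λ path → path)
  suffix (e ∷ w) (here refl) = e ∷ w , (λ v∈ → v∈) , (λ path → path)
  suffix (e ∷ w) (there x∈)  with suffix w x∈
  ... | w' , w'⊆w , w'-path = w' , (λ v∈ → there (w'⊆w v∈)) , λ { (_ ∷ path) → w'-path path }

  toPath : ∀ {x y} (w : Walk G x y) → Σ (Walk G x y) λ π → IsPath G π × verts G π ⊆ verts G w
  toPath []          = [] , ([] ∷ []) , (λ v∈ → v∈)
  toPath {x} (e ∷ w) with toPath w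
  ... | π , path , π⊆w with Any.any? (x ≟_) (verts G π)
  ...   | yes x∈π = let (π' , π'⊆π , π'-path) = suffix π x∈π in
                    π' , π'-path path , (λ v∈ → there (π⊆w (π'⊆π v∈)))
  ...   | no  x∉π = e ∷ π , ¬Any⇒All¬ (verts G π) x∉π ∷ path ,
                    λ { (here refl) → here refl ; (there v∈) → there (π⊆w v∈) }

  κ-self : ∀ r s → κ G r (_≡ s) s
  κ-self r s []      _ = here refl
  κ-self r s (_ ∷ _) _ = here refl

  ¬κ⇒≢ : ∀ {r s x} → ¬ κ G r (_≡ s) x → x ≢ s
  ¬κ⇒≢ {r} {s} s∉κ refl = s∉κ (κ-self r s)

  avoiding⇒¬κ : ∀ {r s x} (w : Walk G x r) → All (_≢ s) (verts G w) → ¬ κ G r (_≡ s) x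
  avoiding⇒¬κ w w-avoids x∈κ =
    let (π , path , π⊆w) = toPath w in All¬⇒¬Any (anti-mono π⊆w w-avoids) (x∈κ π path)

  avoiding⇒All¬κ : ∀ {r s x} (w : Walk G x r) → All (_≢ s) (verts G w) →
    All (λ v → ¬ κ G r (_≡ s) v) (verts G w)
  avoiding⇒All¬κ w w-avoids = All.tabulate λ v∈ →
    let (w' , w'⊆w , _) = suffix w v∈ in avoiding⇒¬κ w' (anti-mono w'⊆w w-avoids)

  ¬κ⇒¬¬avoiding : ∀ {r s x} → ¬ κ G r (_≡ s) x → ¬ (∀ (w : Walk G x r) → ¬ All (_≢ s) (verts G w))
  ¬κ⇒¬¬avoiding {s = s} x∉κ no-avoiding = x∉κ λ w _ → meets w
    where
    meets : ∀ w → Any (_≡ s) (verts G w)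
    meets w with Any.any? (_≟ s) (verts G w)
    ... | yes meets-s = meets-s
    ... | no  avoids  = ⊥-elim (no-avoiding w (¬Any⇒All¬ (verts G w) avoids))

  next-suc : ∀ {m} (i : Fin (suc m)) → toℕ i < m → toℕ (next G i) ≡ suc (toℕ i)
  next-suc {suc m} zero    _         = refl
  next-suc {suc m} (suc i) (s≤s i<m) with next G i | next-suc i i<m
  ... | suc j | eq = cong suc eq

  next-last : ∀ {m} (i : Fin (suc m)) → toℕ i ≡ m → next G i ≡ zero
  next-last {zero}  zero    _  = refl
  next-last {suc m} (suc i) eq with next G i | next-last i (suc-injective eq)
  ... | zero | _ = refl

  next-cases : ∀ {m} (i : Fin (suc m)) → toℕ (next G i) ≡ suc (toℕ i) ⊎ (toℕ i ≡ m × next G i ≡ zero)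
  next-cases i with m≤n⇒m<n∨m≡n (toℕ≤pred[n] i)
  ... | inj₁ i<m = inj₁ (next-suc i i<m)
  ... | inj₂ i≡m = inj₂ (i≡m , next-last i i≡m)

  Chain : List V → V → Set
  Chain []           t = ⊥
  Chain (x ∷ [])     t = Adj G x t
  Chain (x ∷ y ∷ xs) t = Adj G x y × Chain (y ∷ xs) t

  walk-chain : ∀ {x z t} rest (w : Walk G x z) → Chain (z ∷ rest) t → Chain (verts G w ++ rest) t
  walk-chain rest []           chain = chain
  walk-chain rest (e ∷ [])     chain = e , chain
  walk-chain rest (e ∷ e' ∷ w) chain = e , walk-chain rest (e' ∷ w) chain

  verts-++-nonempty : ∀ {x y} (w : Walk G x y) xs → verts G w ++ xs ≢ []
  verts-++-nonempty []      xs ()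
  verts-++-nonempty (_ ∷ _) xs ()

  applyUpTo-chain : ∀ {t} (g : ℕ → V) m → (∀ s → s < m → Adj G (g s) (g (suc s))) →
    Adj G (g m) t → Chain (applyUpTo g (suc m)) t
  applyUpTo-chain g zero    steps last = last
  applyUpTo-chain g (suc m) steps last =
    steps 0 (s≤s z≤n) , applyUpTo-chain (λ s → g (suc s)) m (λ s s<m → steps (suc s) (s≤s s<m)) last

  chain-lookup : ∀ {t} xs → Chain xs t → ∀ (i j : Fin (length xs)) →
    toℕ j ≡ suc (toℕ i) → Adj G (lookup xs i) (lookup xs j)
  chain-lookup (x ∷ y ∷ xs) (e , _)     zero    (suc zero) _  = e
  chain-lookup (x ∷ y ∷ xs) (_ , chain) (suc i) (suc j)    eq = chain-lookup (y ∷ xs) chain i j (suc-injective eq)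

  chain-last : ∀ {t} xs → Chain xs t → ∀ (i : Fin (length xs)) → suc (toℕ i) ≡ length xs → Adj G (lookup xs i) t
  chain-last (x ∷ [])     e         zero    _  = e
  chain-last (x ∷ y ∷ xs) (_ , chain) (suc i) eq = chain-last (y ∷ xs) chain i (suc-injective eq)

  chain⇒IsCycle : ∀ x₀ x₁ x₂ xs → Unique (x₀ ∷ x₁ ∷ x₂ ∷ xs) → Chain (x₀ ∷ x₁ ∷ x₂ ∷ xs) x₀ →
    IsCycle G (lookup (x₀ ∷ x₁ ∷ x₂ ∷ xs))
  chain⇒IsCycle x₀ x₁ x₂ xs unique chain = s≤s (s≤s z≤n) , lookup-injective unique _ _ , step
    where
    L = x₀ ∷ x₁ ∷ x₂ ∷ xs
    step : ∀ i → Adj G (lookup L i) (lookup L (next G i))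
    step i with next-cases i
    ... | inj₁ next≡1+i             = chain-lookup L chain i (next G i) next≡1+i
    ... | inj₂ (i≡last , next≡zero) rewrite next≡zero = chain-last L chain i (cong suc i≡last)

-- min t m as an element of Fin (suc m), so that positions on C can be handled as naturals.
clamp : (m : ℕ) → ℕ → Fin (suc m)
clamp m       zero    = zero
clamp zero    (suc t) = zero
clamp (suc m) (suc t) = suc (clamp m t)

toℕ-clamp : ∀ m t → t ≤ m → toℕ (clamp m t) ≡ t
toℕ-clamp m       zero    _         = refl
toℕ-clamp (suc m) (suc t) (s≤s t≤m) = cong suc (toℕ-clamp m t t≤m)

clamp-toℕ : ∀ m (i : Fin (suc m)) → clamp m (toℕ i) ≡ i
clamp-toℕ m       zero    = refl
clamp-toℕ (suc m) (suc i) = cong suc (clamp-toℕ m i)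

-- For t > 0, the length of the walk r, c p, c (p - 1), …, c t.
back-distance : ℕ → ℕ → ℕ
back-distance p zero    = 0
back-distance p (suc t) = p ∸ t

back-distance-forward : ∀ p t → suc t ≢ 1 → back-distance p (suc t) ≤ suc (back-distance p t)
back-distance-forward p zero    t+1≢1 = ⊥-elim (t+1≢1 refl)
back-distance-forward p (suc t) _     = ≤-trans (∸-monoʳ-≤ p (n≤1+n t)) (n≤1+n _)

back-distance-backward : ∀ p t → back-distance p t ≤ suc (back-distance p (suc t))
back-distance-backward p       zero          = z≤n
back-distance-backward zero    (suc zero)    = z≤n
back-distance-backward zero    (suc (suc t)) = z≤n
back-distance-backward (suc p) (suc zero)    = ≤-refl
back-distance-backward (suc p) (suc (suc t)) = back-distance-backward p (suc t)

back-distance-last : ∀ p → back-distance p p ≤ 1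
back-distance-last zero    = z≤n
back-distance-last (suc p) = ≤-reflexive (m+n∸n≡m 1 p)

climb≤back-distance : ∀ p H t → t ≢ 1 → t < H → H + H ≤ suc (suc (suc p)) → t ≤ back-distance p t
climb≤back-distance p H zero          _   _   _    = z≤n
climb≤back-distance p H (suc zero)    t≢1 _   _    = ⊥-elim (t≢1 refl)
climb≤back-distance p H (suc (suc t)) _   t<H near = m+n≤o⇒m≤o∸n (suc (suc t)) (+-cancelˡ-≤ 3 _ _ (begin
  3 + (suc (suc t) + suc t)             ≡⟨ double-3+ t ⟩
  suc (suc (suc t)) + suc (suc (suc t)) ≤⟨ +-mono-≤ t<H t<H ⟩
  H + H                                 ≤⟨ near ⟩
  3 + p                                 ∎))
  where
  open ≤-Reasoning
  double-3+ : ∀ t → 3 + (suc (suc t) + suc t) ≡ suc (suc (suc t)) + suc (suc (suc t))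
  double-3+ = solve-∀

descend≤back-distance : ∀ p t → 0 < t → t ≤ p → suc (p ∸ t) ≤ back-distance p t
descend≤back-distance (suc p) (suc t) _ (s≤s t≤p) = ≤-reflexive (sym (+-∸-assoc 1 t≤p))

descend≤climb : ∀ p H t → suc (suc (suc p)) < H + H → H < t → suc (p ∸ t) ≤ t
descend≤climb p H (suc t) far H<t = m<n+o⇒m∸n<o p (suc t)
  (<-trans (≤-<-trans (m≤n+m p 3) far) (+-mono-< H<t H<t))

module OnCycle (G : Graph) (r : Fin (n G)) (p : ℕ) (u : Fin p → Fin (n G))
  (one-cycle : AtMostOneCycle G) (C-cycle : IsCycle G (cyc G r u)) where

  open Walks G

  c : Fin (suc p) → V
  c = cyc G r u

  c-injective : ∀ {i j} → c i ≡ c j → i ≡ j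
  c-injective = proj₁ (proj₂ C-cycle)

  pos : ℕ → V
  pos t = c (clamp p t)

  c≡pos : ∀ i → c i ≡ pos (toℕ i)
  c≡pos i = cong c (sym (clamp-toℕ p i))

  pos-injective : ∀ {t t'} → t ≤ p → t' ≤ p → pos t ≡ pos t' → t ≡ t'
  pos-injective {t} {t'} t≤p t'≤p eq =
    trans (sym (toℕ-clamp p t t≤p)) (trans (cong toℕ (c-injective eq)) (toℕ-clamp p t' t'≤p))

  pos-adj : ∀ t → t < p → Adj G (pos t) (pos (suc t))
  pos-adj t t<p = subst (λ i → Adj G (pos t) (c i)) next≡ (proj₂ (proj₂ C-cycle) (clamp p t))
    where
    next≡ : next G (clamp p t) ≡ clamp p (suc t)
    next≡ = toℕ-injective (begin
      toℕ (next G (clamp p t)) ≡⟨ next-suc (clamp p t) (subst (_< p) (sym (toℕ-clamp p t (<⇒≤ t<p))) t<p) ⟩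
      suc (toℕ (clamp p t))    ≡⟨ cong suc (toℕ-clamp p t (<⇒≤ t<p)) ⟩
      suc t                    ≡⟨ sym (toℕ-clamp p (suc t) t<p) ⟩
      toℕ (clamp p (suc t))    ∎)
      where open ≡-Reasoning

  pos-close : Adj G (pos p) r
  pos-close = subst (λ i → Adj G (pos p) (c i)) (next-last (clamp p p) (toℕ-clamp p p ≤-refl))
    (proj₂ (proj₂ C-cycle) (clamp p p))

  OnCycle : V → Set
  OnCycle x = ∃ λ l → c l ≡ x

  onCycle? : ∀ x → Dec (OnCycle x)
  onCycle? x = any? (λ l → c l ≟ x)

  Adjacent : Fin (suc p) → Fin (suc p) → Set
  Adjacent i k = next G i ≡ k ⊎ next G k ≡ i

  Adjacent-sym : ∀ {i k} → Adjacent i k → Adjacent k i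
  Adjacent-sym (inj₁ eq) = inj₂ eq
  Adjacent-sym (inj₂ eq) = inj₁ eq

  closed-chain-leaves-along-C : ∀ i x₁ xs → xs ≢ [] → Unique (c i ∷ x₁ ∷ xs) → Chain (c i ∷ x₁ ∷ xs) (c i) →
    ∃ λ l → c l ≡ x₁ × Adjacent i l
  closed-chain-leaves-along-C i x₁ []        xs≢[] _      _     = ⊥-elim (xs≢[] refl)
  closed-chain-leaves-along-C i x₁ (x₂ ∷ xs) _     unique chain
    with Equivalence.to (one-cycle _ c (chain⇒IsCycle (c i) x₁ x₂ xs unique chain) C-cycle (c i) x₁)
                        (zero , inj₁ (refl , refl))
  ... | l , inj₁ (cl≡ci , c[next-l]≡x₁) = next G l , c[next-l]≡x₁ , inj₁ (cong (next G) (sym (c-injective cl≡ci)))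
  ... | l , inj₂ (cl≡x₁ , c[next-l]≡ci) = l , cl≡x₁ , inj₂ (c-injective c[next-l]≡ci)

  Internal : ∀ {x y} → Walk G x y → Set
  Internal {x} {y} π = ∀ {z} → z ∈ verts G π → z ≢ x → z ≢ y → ¬ OnCycle z

  module Detour (i k : Fin (suc p)) (gap : ℕ) (k+gap<i : suc (toℕ k + gap) ≡ toℕ i) where

    private
      b = toℕ k

      i≤p : toℕ i ≤ p
      i≤p = toℕ≤pred[n] i

      b+gap<p : b + gap < p
      b+gap<p = subst (_≤ p) (sym k+gap<i) i≤p

      arc-pos≤p : ∀ t → t < gap → b + suc t ≤ p
      arc-pos≤p t t<gap = ≤-trans (+-monoʳ-≤ b t<gap) (<⇒≤ b+gap<p)

    arc : List V
    arc = applyUpTo (λ t → pos (b + suc t)) gap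

    arc-chain : Chain (c k ∷ arc) (c i)
    arc-chain = subst (λ z → Chain (z ∷ arc) (c i)) (trans (cong pos (+-identityʳ b)) (sym (c≡pos k)))
      (applyUpTo-chain (λ t → pos (b + t)) gap step last)
      where
      step : ∀ s → s < gap → Adj G (pos (b + s)) (pos (b + suc s))
      step s s<gap = subst (λ t → Adj G (pos (b + s)) (pos t)) (sym (+-suc b s))
        (pos-adj (b + s) (subst (_≤ p) (+-suc b s) (arc-pos≤p s s<gap)))
      last : Adj G (pos (b + gap)) (c i)
      last = subst (Adj G (pos (b + gap))) (trans (cong pos k+gap<i) (sym (c≡pos i))) (pos-adj (b + gap) b+gap<p)

    arc-unique : Unique arc
    arc-unique = Unique.applyUpTo⁺₁ _ gap λ {t} {t'} t<t' t'<gap eq → <⇒≢ t<t'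
      (suc-injective (+-cancelˡ-≡ b _ _ (pos-injective (arc-pos≤p t (<-trans t<t' t'<gap)) (arc-pos≤p t' t'<gap) eq)))

    arc-disjoint : (π : Walk G (c i) (c k)) → Internal π → ∀ {z} → ¬ (z ∈ verts G π × z ∈ arc)
    arc-disjoint π internal (z∈π , z∈arc) with ∈-applyUpTo⁻ (λ t → pos (b + suc t)) z∈arc
    ... | t , t<gap , refl with pos (b + suc t) ≟ c i | pos (b + suc t) ≟ c k
    ... | yes z≡ci | _       = <⇒≢ t<gap (suc-injective (+-cancelˡ-≡ b _ _
          (trans (pos-injective (arc-pos≤p t t<gap) i≤p (trans z≡ci (c≡pos i)))
                 (trans (sym k+gap<i) (sym (+-suc b gap))))))
    ... | no _     | yes z≡ck = m+1+n≢m b (pos-injective (arc-pos≤p t t<gap) (toℕ≤pred[n] k) (trans z≡ck (c≡pos k)))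
    ... | no z≢ci  | no z≢ck  = internal z∈π z≢ci z≢ck (clamp p (b + suc t) , refl)

    closed-detour : (π : Walk G (c i) (c k)) → IsPath G π → Internal π →
      Unique (verts G π ++ arc) × Chain (verts G π ++ arc) (c i)
    closed-detour π path internal = Unique.++⁺ path arc-unique (arc-disjoint π internal) , walk-chain arc π arc-chain

  -- The path followed by the arc of C strictly between c k and c i is a cycle of G, so its first
  -- edge is an edge of C; that edge can only lead back to C at c k.
  chord-core : ∀ i k → toℕ k < toℕ i → ∀ {x y} (π : Walk G x y) → c i ≡ x → c k ≡ y →
    IsPath G π → Internal π → Adjacent i k × len G π ≡ 1
  chord-core i k k<i [] refl ck≡ci _ _ = ⊥-elim (<⇒≢ k<i (cong toℕ (c-injective ck≡ci)))
  chord-core i k k<i (e ∷ []) refl refl path internal with m≤n⇒∃[o]m+o≡n k<i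
  ... | zero , k+1≡i =
    inj₂ (toℕ-injective (trans (next-suc k (<-≤-trans k<i (toℕ≤pred[n] i)))
                               (trans (cong suc (sym (+-identityʳ (toℕ k)))) k+1≡i))) , refl
  ... | suc gap , k+gap<i =
    let open Detour i k (suc gap) k+gap<i
        (unique , chain) = closed-detour (e ∷ []) path internal
        (l , cl≡ck , i~l) = closed-chain-leaves-along-C i (c k) arc (λ ()) unique chain
    in subst (Adjacent i) (c-injective cl≡ck) i~l , refl
  chord-core i k k<i (_∷_ {y = s} e (e' ∷ π)) refl refl path@(ci∉ ∷ s∉ ∷ _) internal =
    let (gap , k+gap<i) = m≤n⇒∃[o]m+o≡n k<i
        open Detour i k gap k+gap<i
        (unique , chain) = closed-detour (e ∷ e' ∷ π) path internal
        (l , cl≡s , _) = closed-chain-leaves-along-C i s (verts G π ++ arc) (verts-++-nonempty π arc) unique chain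
    in ⊥-elim (internal (there (here refl)) (λ s≡ci → All.head ci∉ (sym s≡ci))
                        (All.lookup s∉ (target∈verts π)) (l , cl≡s))

  chord : ∀ {i k} → i ≢ k → (π : Walk G (c i) (c k)) → IsPath G π → Internal π → Adjacent i k × len G π ≡ 1
  chord {i} {k} i≢k π path internal with <-cmp (toℕ k) (toℕ i)
  ... | tri< k<i _ _ = chord-core i k k<i π refl refl path internal
  ... | tri≈ _ k≡i _ = ⊥-elim (i≢k (toℕ-injective (sym k≡i)))
  ... | tri> _ _ i<k =
    let (k~i , len≡1) = chord-core k i i<k (reverse π) refl refl (reverse-isPath π path)
                          (λ z∈ z≢ck z≢ci → internal (verts-reverse⊆ π z∈) z≢ci z≢ck)
    in Adjacent-sym k~i , trans (sym (len-reverse π)) len≡1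

  Excursion : ∀ {x y} → Walk G x y → Set
  Excursion []      = ⊤
  Excursion (_ ∷ σ) = All (λ z → ¬ OnCycle z) (verts G σ)

  excursion-internal : ∀ {x y z} (σ : Walk G x y) → Excursion σ → z ∈ verts G σ → z ≢ x → ¬ OnCycle z
  excursion-internal []      _   (here refl) z≢x = ⊥-elim (z≢x refl)
  excursion-internal (_ ∷ σ) _   (here refl) z≢x = ⊥-elim (z≢x refl)
  excursion-internal (_ ∷ σ) exc (there z∈σ) _   = All.lookup exc z∈σ

  excursion-ends-adjacent : ∀ {i k a} (σ : Walk G (c i) a) → Excursion σ → Adj G a (c k) → i ≢ k → Adjacent i k
  excursion-ends-adjacent {i} {k} σ exc e i≢k =
    let (π , path , π⊆σe) = toPath (σ ▷ e) in proj₁ (chord i≢k π path (internal π⊆σe))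
    where
    internal : ∀ {π : Walk G (c i) (c k)} → verts G π ⊆ verts G (σ ▷ e) → Internal π
    internal π⊆σe {z} z∈π z≢ci z≢ck with ∈-++⁻ (verts G σ) (subst (z ∈_) (verts-▷ σ e) (π⊆σe z∈π))
    ... | inj₁ z∈σ         = excursion-internal σ exc z∈σ z≢ci
    ... | inj₂ (here refl) = ⊥-elim (z≢ck refl)

  first-hit : ∀ {y z} (ω : Walk G y z) → OnCycle z →
    Σ (Fin (suc p)) λ k → Σ (Walk G y (c k)) λ ω' →
      verts G ω' ⊆ verts G ω × (∀ {x} → x ∈ verts G ω' → x ≡ c k ⊎ ¬ OnCycle x)
  first-hit {y} ω z-on with onCycle? y
  ... | yes (k , refl) = k , [] , (λ { (here refl) → source∈verts ω }) , (λ { (here refl) → inj₁ refl })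
  first-hit []      z-on | no y-off = ⊥-elim (y-off z-on)
  first-hit (e ∷ ω) z-on | no y-off with first-hit ω z-on
  ... | k , ω' , ω'⊆ω , shape = k , e ∷ ω' , (λ { (here refl) → here refl ; (there x∈) → there (ω'⊆ω x∈) }) ,
        (λ { (here refl) → inj₂ y-off ; (there x∈) → shape x∈ })

  leaves-off-cycle : ∀ {y k} (π : Walk G y (c k)) → ¬ OnCycle y → len G π ≢ 0
  leaves-off-cycle {k = k} [] y-off _ = y-off (k , refl)
  leaves-off-cycle (_ ∷ _) _ ()

  excursion-return : ∀ {H v} (σ : Walk G (c H) v) → Excursion σ → (q : Walk G v r) → ¬ All (_≢ c H) (verts G q)
  excursion-return [] _ q q-avoids = All.lookup q-avoids (source∈verts q) refl
  excursion-return {H} (_∷_ {y = y} e σ) exc q q-avoids =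
    leaves-off-cycle {k = k} π (All.lookup exc (source∈verts σ))
      (suc-injective (proj₂ (chord H≢k (e ∷ π) path internal)))
    where
    ω = σ ++ʷ q
    hit = first-hit ω (zero , refl)
    k = proj₁ hit
    ω' = proj₁ (proj₂ hit)
    ω'⊆ω = proj₁ (proj₂ (proj₂ hit))
    ω'-shape = proj₂ (proj₂ (proj₂ hit))
    π = proj₁ (toPath ω')
    π⊆ω' = proj₂ (proj₂ (toPath ω'))
    π-avoids : All (_≢ c H) (verts G π)
    π-avoids = anti-mono (λ z∈ → ω'⊆ω (π⊆ω' z∈))
      (All-++ʷ σ q (All.map (λ z-off z≡cH → z-off (H , sym z≡cH)) exc) q-avoids)
    H≢k : H ≢ k
    H≢k H≡k = All.lookup π-avoids (target∈verts π) (cong c (sym H≡k))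
    path : IsPath G (e ∷ π)
    path = All.map (λ z≢cH cH≡z → z≢cH (sym cH≡z)) π-avoids ∷ proj₁ (proj₂ (toPath ω'))
    internal : Internal (e ∷ π)
    internal (here refl) z≢cH _    = ⊥-elim (z≢cH refl)
    internal (there z∈π) _    z≢ck with ω'-shape (π⊆ω' z∈π)
    ... | inj₁ z≡ck = ⊥-elim (z≢ck z≡ck)
    ... | inj₂ z-off = z-off

  InArc : ℕ → ℕ → V → Set
  InArc lo hi x = ∃ λ l → lo ≤ l × l ≤ hi × x ≡ pos l

  climb : ∀ s m → s + m ≤ p → Σ (Walk G (pos s) (pos (s + m))) λ W → len G W ≡ m × All (InArc s (s + m)) (verts G W)
  climb s zero    _ rewrite +-identityʳ s = [] , refl , (s , ≤-refl , ≤-refl , refl) ∷ []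
  climb s (suc m) s+m<p with climb s m (≤-trans (+-monoʳ-≤ s (n≤1+n m)) s+m<p)
  ... | W , len≡m , in-arc rewrite +-suc s m =
    W ▷ pos-adj (s + m) s+m<p , trans (len-▷ W _) (cong suc len≡m) ,
    All-▷ W _ (All.map (λ (l , s≤l , l≤ , x≡) → l , s≤l , ≤-trans l≤ (n≤1+n _) , x≡) in-arc)
              (suc (s + m) , ≤-trans (m≤m+n s m) (n≤1+n _) , ≤-refl , refl)

  ArcAvoiding : Fin (suc p) → V → Set
  ArcAvoiding H x = x ≢ c H × OnCycle x

  InArc⇒ArcAvoiding : ∀ {lo hi x} H → hi ≤ p → (∀ l → lo ≤ l → l ≤ hi → l ≢ toℕ H) → InArc lo hi x → ArcAvoiding H x
  InArc⇒ArcAvoiding H hi≤p l≢H (l , lo≤l , l≤hi , refl) =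
    (λ eq → l≢H l lo≤l l≤hi (pos-injective (≤-trans l≤hi hi≤p) (toℕ≤pred[n] H) (trans eq (c≡pos H)))) ,
    (clamp p l , refl)

  arc-from-root : ∀ H i → H ≢ zero → i ≢ H → (B : ℕ) →
    (toℕ i < toℕ H → toℕ i ≤ B) → (toℕ H < toℕ i → suc (p ∸ toℕ i) ≤ B) →
    Σ (Walk G r (c i)) λ W → len G W ≤ B × All (ArcAvoiding H) (verts G W)
  arc-from-root H i H≢0 i≢H B upward downward =
    subst (λ z → Σ (Walk G r z) λ W → len G W ≤ B × All (ArcAvoiding H) (verts G W)) (sym (c≡pos i)) walk
    where
    t = toℕ i
    t≤p = toℕ≤pred[n] i
    walk : Σ (Walk G r (pos t)) λ W → len G W ≤ B × All (ArcAvoiding H) (verts G W)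
    walk with <-cmp t (toℕ H)
    ... | tri≈ _ t≡H _ = ⊥-elim (i≢H (toℕ-injective t≡H))
    ... | tri< t<H _ _ =
      let (W , len≡t , in-arc) = climb 0 t t≤p in
      W , subst (_≤ B) (sym len≡t) (upward t<H) ,
      All.map (InArc⇒ArcAvoiding H t≤p λ l _ l≤t → <⇒≢ (≤-<-trans l≤t t<H)) in-arc
    ... | tri> _ _ H<t with climb t (p ∸ t) (subst (_≤ p) (sym (m+[n∸m]≡n t≤p)) ≤-refl)
    ...   | W , len≡ , in-arc rewrite m+[n∸m]≡n t≤p =
      Graph.sym G pos-close ∷ reverse W , subst (_≤ B) (cong suc (sym (trans (len-reverse W) len≡))) (downward H<t) ,
      ((λ r≡cH → H≢0 (sym (c-injective r≡cH))) , (zero , refl)) ∷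
      anti-mono (verts-reverse⊆ W)
        (All.map (InArc⇒ArcAvoiding H ≤-refl λ l t≤l _ l≡H → <⇒≢ (<-≤-trans H<t t≤l) (sym l≡H)) in-arc)

  record Potential (H J : Fin (suc p)) : Set where
    field
      φ           : Fin (suc p) → ℕ
      φ-root      : φ zero ≡ 0
      φ-lipschitz : ∀ i k → Adjacent i k → i ≢ J → k ≢ J → φ k ≤ suc (φ i)
      φ-reach     : ∀ i → i ≢ H → i ≢ J → Σ (Walk G r (c i)) λ W → len G W ≤ φ i × All (ArcAvoiding H) (verts G W)

  Excursion-▷ : ∀ {x y z} (σ : Walk G x y) (e : Adj G y z) → Excursion σ → ¬ OnCycle z → Excursion (σ ▷ e)
  Excursion-▷ []      e _   z-off = z-off ∷ []
  Excursion-▷ (_ ∷ σ) e exc z-off = All-▷ σ e exc z-off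

  module Tracking (J : Fin (suc p)) (φ : Fin (suc p) → ℕ)
    (φ-lipschitz : ∀ i k → Adjacent i k → i ≢ J → k ≢ J → φ k ≤ suc (φ i)) (R : V → Set) where

    -- c i is the last vertex of C on a walk of length ℓ to a, and σ continues from there to a off C.
    Anchored : V → ℕ → Set
    Anchored a ℓ = Σ (Fin (suc p)) λ i → Σ (Walk G (c i) a) λ σ →
      i ≢ J × len G σ + φ i ≤ ℓ × Excursion σ × All R (verts G σ)

    φ-anchor≤ : ∀ {i a ℓ} (σ : Walk G (c i) a) → len G σ + φ i ≤ ℓ → φ i ≤ ℓ
    φ-anchor≤ {i} σ = ≤-trans (m≤n+m (φ i) (len G σ))

    anchored-step : ∀ {a a' ℓ} → Anchored a ℓ → Adj G a a' → a' ≢ c J → R a' → Anchored a' (suc ℓ)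
    anchored-step {a' = a'} {ℓ} (i , σ , i≢J , bound , exc , σ∈R) e a'≢cJ Ra' with onCycle? a'
    ... | no a'-off =
      i , σ ▷ e , i≢J , subst (λ m → m + φ i ≤ suc ℓ) (sym (len-▷ σ e)) (s≤s bound) ,
      Excursion-▷ σ e exc a'-off , All-▷ σ e σ∈R Ra'
    ... | yes (k , refl) with i ≟ k
    ...   | yes refl = i , [] , i≢J , ≤-trans (φ-anchor≤ σ bound) (n≤1+n ℓ) , tt , Ra' ∷ []
    ...   | no  i≢k  = k , [] , k≢J ,
      ≤-trans (φ-lipschitz i k (excursion-ends-adjacent σ exc e i≢k) i≢J k≢J) (s≤s (φ-anchor≤ σ bound)) ,
      tt , Ra' ∷ []
      where
      k≢J : k ≢ J
      k≢J k≡J = a'≢cJ (cong c k≡J)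

    anchored-walk : ∀ {a v ℓ} (ω : Walk G a v) → All (λ x → x ≢ c J × R x) (verts G ω) →
      Anchored a ℓ → Anchored v (len G ω + ℓ)
    anchored-walk []      _        anchored = anchored
    anchored-walk (e ∷ ω) (_ ∷ ω∈) anchored =
      let (≢cJ , R-next) = All.lookup ω∈ (source∈verts ω) in
      subst (Anchored _) (+-suc (len G ω) _) (anchored-walk ω ω∈ (anchored-step anchored e ≢cJ R-next))

  RootOrCovered : V → Set
  RootOrCovered x = x ≡ r ⊎ κ G r (λ y → ∃ λ i → u i ≡ y) x

  OnCycle⇒RootOrCovered : ∀ {x} → OnCycle x → RootOrCovered x
  OnCycle⇒RootOrCovered (zero  , refl) = inj₁ refl
  OnCycle⇒RootOrCovered (suc l , refl) = inj₂ λ { [] _ → here (l , refl) ; (_ ∷ _) _ → here (l , refl) }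

  excursion-avoids : ∀ {i v} H (σ : Walk G (c i) v) → Excursion σ → i ≢ H → All (_≢ c H) (verts G σ)
  excursion-avoids H []      _   i≢H = (λ ci≡cH → i≢H (c-injective ci≡cH)) ∷ []
  excursion-avoids H (_ ∷ σ) exc i≢H =
    (λ ci≡cH → i≢H (c-injective ci≡cH)) ∷ All.map (λ z-off z≡cH → z-off (H , sym z≡cH)) exc

  shortcut-in-T : ∀ {h i v} (W : Walk G r (c i)) → All (ArcAvoiding (suc h)) (verts G W) →
    (σ : Walk G (c i) v) → Excursion σ → All RootOrCovered (verts G σ) → i ≢ suc h →
    (q : Walk G v r) → All (_≢ u h) (verts G q) → All (TminusV G r u h) (verts G (W ++ʷ σ))
  shortcut-in-T {h} W W-avoids σ exc σ∈ i≢H q q-avoids =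
    All.zip (All-++ʷ W σ (All.map (λ (_ , on) → OnCycle⇒RootOrCovered on) W-avoids) σ∈ ,
             anti-mono (verts⊆-++ʷˡ (W ++ʷ σ) q) (avoiding⇒All¬κ ((W ++ʷ σ) ++ʷ q) Wσq-avoids))
    where
    Wσq-avoids : All (_≢ u h) (verts G ((W ++ʷ σ) ++ʷ q))
    Wσq-avoids = All-++ʷ (W ++ʷ σ) q
      (All-++ʷ W σ (All.map proj₁ W-avoids) (excursion-avoids (suc h) σ exc i≢H)) q-avoids

  far-transfer : ∀ {h j} → Potential (suc h) (suc j) → ∀ d v →
    FarIn G r (TminusV G r u h) d v → ¬ κ G r (_≡ u j) v → FarIn G r (TminusV G r u j) d v
  far-transfer {h} {j} Φ d v ((v∈ , v∉κh) , far-h) v∉κj = (v∈ , v∉κj) , λ w w∈Tj len<d →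
    ¬κ⇒¬¬avoiding v∉κh λ q q-avoids → too-short w w∈Tj len<d q q-avoids
      (anchored-walk w (All.map (λ (x∈ , x∉κj) → ¬κ⇒≢ x∉κj , x∈) w∈Tj)
         (zero , [] , (λ ()) , subst (_≤ 0) (sym φ-root) ≤-refl , tt , inj₁ refl ∷ []))
    where
    open Potential Φ
    open Tracking (suc j) φ φ-lipschitz RootOrCovered
    too-short : (w : Walk G r v) → All (TminusV G r u j) (verts G w) → len G w < d →
      (q : Walk G v r) → All (_≢ u h) (verts G q) → Anchored v (len G w + 0) → ⊥
    too-short w w∈Tj len<d q q-avoids (i , σ , i≢J , bound , exc , σ∈) with i ≟ suc h
    ... | yes refl = excursion-return σ exc q q-avoids
    ... | no  i≢H  =
      let (W , len-W , W-avoids) = φ-reach i i≢H i≢J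
          open ≤-Reasoning
      in far-h (W ++ʷ σ) (shortcut-in-T W W-avoids σ exc σ∈ i≢H q q-avoids) (begin-strict
        len G (W ++ʷ σ)   ≡⟨ len-++ʷ W σ ⟩
        len G W + len G σ ≤⟨ +-monoˡ-≤ (len G σ) len-W ⟩
        φ i + len G σ     ≡⟨ +-comm (φ i) (len G σ) ⟩
        len G σ + φ i     ≤⟨ bound ⟩
        len G w + 0       ≡⟨ +-identityʳ (len G w) ⟩
        len G w           <⟨ len<d ⟩
        d                 ∎)

  count-bound : ∀ {h j} → Potential (suc h) (suc j) → ∀ (d a b k : ℕ) →
    IsCard (FarIn G r (TminusV G r u h) d) a → IsCard (FarIn G r (TminusV G r u j) d) b →
    IsCard (κ G r (λ x → x ≡ u j)) k → a ≤ b + k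
  count-bound Φ d _ _ _ = IsCard-≤-+ (far-transfer Φ d)

  data CycleStep (i k : Fin (suc p)) : Set where
    forward       : toℕ k ≡ suc (toℕ i) → CycleStep i k
    backward      : toℕ i ≡ suc (toℕ k) → CycleStep i k
    wrap-forward  : toℕ i ≡ p → k ≡ zero → CycleStep i k
    wrap-backward : toℕ k ≡ p → i ≡ zero → CycleStep i k

  Adjacent⇒CycleStep : ∀ {i k} → Adjacent i k → CycleStep i k
  Adjacent⇒CycleStep {i} (inj₁ refl) with next-cases i
  ... | inj₁ next≡1+i          = forward next≡1+i
  ... | inj₂ (i≡p , next≡zero) = wrap-forward i≡p next≡zero
  Adjacent⇒CycleStep {k = k} (inj₂ refl) with next-cases k
  ... | inj₁ next≡1+k          = backward next≡1+k
  ... | inj₂ (k≡p , next≡zero) = wrap-backward k≡p next≡zero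

  first-potential : ∀ {H J} → toℕ J ≡ 1 → H ≢ zero → toℕ H + toℕ H ≤ suc (suc (suc p)) → Potential H J
  first-potential {H} {J} J≡1 H≢0 near = record
    { φ           = φ
    ; φ-root      = refl
    ; φ-lipschitz = lipschitz
    ; φ-reach     = λ i i≢H i≢J → arc-from-root H i H≢0 i≢H (φ i)
        (λ i<H → climb≤back-distance p (toℕ H) (toℕ i) (λ i≡1 → i≢J (toℕ-injective (trans i≡1 (sym J≡1)))) i<H near)
        (λ H<i → descend≤back-distance p (toℕ i) (≤-<-trans z≤n H<i) (toℕ≤pred[n] i))
    }
    where
    φ : Fin (suc p) → ℕ
    φ i = back-distance p (toℕ i)
    lipschitz : ∀ i k → Adjacent i k → i ≢ J → k ≢ J → φ k ≤ suc (φ i)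
    lipschitz i k i~k _ k≢J with Adjacent⇒CycleStep i~k
    ... | forward k≡1+i  = subst (λ t → back-distance p t ≤ suc (φ i)) (sym k≡1+i)
          (back-distance-forward p (toℕ i) (λ 1+i≡1 → k≢J (toℕ-injective (trans k≡1+i (trans 1+i≡1 (sym J≡1))))))
    ... | backward i≡1+k = subst (λ t → φ k ≤ suc (back-distance p t)) (sym i≡1+k) (back-distance-backward p (toℕ k))
    ... | wrap-forward _ refl    = z≤n
    ... | wrap-backward k≡p refl = subst (λ t → back-distance p t ≤ 1) (sym k≡p) (back-distance-last p)

  last-potential : ∀ {H J} → toℕ J ≡ p → H ≢ zero → suc (suc (suc p)) < toℕ H + toℕ H → Potential H J
  last-potential {H} {J} J≡p H≢0 far = record
    { φ           = toℕ
    ; φ-root      = refl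
    ; φ-lipschitz = lipschitz
    ; φ-reach     = λ i i≢H i≢J →
        arc-from-root H i H≢0 i≢H (toℕ i) (λ _ → ≤-refl) (descend≤climb p (toℕ H) (toℕ i) far)
    }
    where
    lipschitz : ∀ i k → Adjacent i k → i ≢ J → k ≢ J → toℕ k ≤ suc (toℕ i)
    lipschitz i k i~k i≢J k≢J with Adjacent⇒CycleStep i~k
    ... | forward k≡1+i     = ≤-reflexive k≡1+i
    ... | backward i≡1+k    = subst (λ t → toℕ k ≤ suc t) (sym i≡1+k) (≤-trans (n≤1+n _) (n≤1+n _))
    ... | wrap-forward i≡p _  = ⊥-elim (i≢J (toℕ-injective (trans i≡p (sym J≡p))))
    ... | wrap-backward k≡p _ = ⊥-elim (k≢J (toℕ-injective (trans k≡p (sym J≡p))))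

lemma4 : (G : Graph) (r : Fin (n G)) (p : ℕ) (u : Fin p → Fin (n G)) →
    OneAlmostTree G → IsCycle G (cyc G r u) →
    ∀ (h : Fin p) → ∃ λ (j : Fin p) → (toℕ j ≡ 0 ⊎ suc (toℕ j) ≡ p) ×
      (∀ (d a b c : ℕ) →
        IsCard (FarIn G r (TminusV G r u h) d) a →
        IsCard (FarIn G r (TminusV G r u j) d) b →
        IsCard (κ G r (λ x → x ≡ u j)) c →
        a ≤ b + c)
lemma4 G r (suc q) u (_ , one-cycle) C-cycle h with suc (suc (suc (suc q))) <? suc (toℕ h) + suc (toℕ h)
... | yes far  = fromℕ q , inj₂ last≡p , count-bound (last-potential last≡p (λ ()) far)
  where
  open OnCycle G r (suc q) u one-cycle C-cycle
  last≡p : suc (toℕ (fromℕ q)) ≡ suc q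
  last≡p = cong suc (toℕ-fromℕ q)
... | no  near = zero , inj₁ refl , count-bound (first-potential refl (λ ()) (≮⇒≥ near))
  where open OnCycle G r (suc q) u one-cycle C-cycle
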